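{- For $k\ge1$ let $Q_k=p((+(+-)^k)^k++)$, and let $\mathcal{A}$ be any infinite subfamily of $\{Q_k\mid k\ge1\}$. Then $\mathcal{A}$ is an antichain of paths and there is no finite family $\mathcal{D}$ of finite directed graphs such that $(\mathcal{A},\mathcal{D})$ is a duality pair.
   Context: A (finite directed) graph is a pair $(V,E)$ with $V$ finite, $E\subseteq V^2$. A homomorphism $G\to H$ is a map $V(G)\to V(H)$ sending edges to edges; $G\to H$ means one exists. A family of graphs is an antichain if there is no homomorphism between any two distinct members. For a word $x=x_1\ldots x_k\in\{+,-\}^k$, $p(x)$ denotes the oriented path with vertices $w_0,\dots,w_k$, the $i$-th edge being $(w_{i-1},w_i)$ if $x_i=+$ and $(w_i,w_{i-1})$ if $x_i=-$; juxtaposition denotes concatenation of words and $y^k$ the concatenation of $k$ copies of $y$. A duality pair is a pair $(\mathcal{A},\mathcal{D})$ of families of graphs such that for every graph $G$ exactly one holds: $A\to G$ for some $A\in\mathcal{A}$, or $G\to D$ for some $D\in\mathcal{D}$. -}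

module Defs where

open import Data.Nat using (ℕ; zero; suc; _≤_)
open import Data.Fin using (Fin; toℕ)
open import Data.Bool using (Bool; true; false; T)
open import Data.List using (List; []; _∷_; _++_; length)
open import Data.List.Membership.Propositional using (_∈_)
open import Data.Product using (Σ; ∃; _×_)
open import Data.Sum using (_⊎_)
open import Relation.Nullary using (¬_)
open import Relation.Binary.PropositionalEquality using (_≡_)

record Graph : Set where
  field
    size : ℕ
    edge : Fin size → Fin size → Bool

open Graph public

Edge : (G : Graph) → Fin (size G) → Fin (size G) → Set
Edge G u v = T (edge G u v)

_⟶_ : Graph → Graph → Set
G ⟶ H = Σ (Fin (size G) → Fin (size H)) λ f →
          ∀ u v → Edge G u v → Edge H (f u) (f v)

data Sign : Set where
  ⊕ ⊖ : Sign

isPlus : Sign → Bool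
isPlus ⊕ = true
isPlus ⊖ = false

isMinus : Sign → Bool
isMinus ⊕ = false
isMinus ⊖ = true

-- edge relation of p(x) on vertex indices 0..k:
-- the i-th letter (0-based here) joins w_i and w_{i+1}
pathEdge : List Sign → ℕ → ℕ → Bool
pathEdge []       _             _             = false
pathEdge (s ∷ xs) zero          (suc zero)    = isPlus s
pathEdge (s ∷ xs) (suc zero)    zero          = isMinus s
pathEdge (s ∷ xs) (suc (suc a)) (suc (suc b)) = pathEdge (xs) (suc a) (suc b)
pathEdge (s ∷ xs) (suc zero)    (suc (suc b)) = pathEdge xs zero (suc b)
pathEdge (s ∷ xs) (suc (suc a)) (suc zero)    = pathEdge xs (suc a) zero
pathEdge (s ∷ xs) _             _             = false

p : List Sign → Graph
p x = record { size = suc (length x) ; edge = λ u v → pathEdge x (toℕ u) (toℕ v) }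

rep : ℕ → List Sign → List Sign
rep zero    y = []
rep (suc k) y = y ++ rep k y

Q : ℕ → Graph
Q k = p (rep k (⊕ ∷ rep k (⊕ ∷ ⊖ ∷ [])) ++ (⊕ ∷ ⊕ ∷ []))

-- A family indexed by S ⊆ ℕ: members Q_k with S k
InfiniteIndexSet : (ℕ → Set) → Set
InfiniteIndexSet S = (∀ k → S k → 1 ≤ k) × (∀ m → ∃ λ k → m ≤ k × S k)

QAntichain : (ℕ → Set) → Set
QAntichain S = ∀ j k → S j → S k → ¬ (j ≡ k) → ¬ (Q j ⟶ Q k)

QDualityPair : (ℕ → Set) → List Graph → Set
QDualityPair S 𝒟 = ∀ G →
  let A = ∃ λ k → S k × (Q k ⟶ G)
      B = ∃ λ D → D ∈ 𝒟 × (G ⟶ D)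
  in (A ⊎ B) × ¬ (A × B)

-- Number the vertices of an oriented path p(W) as w_0, w_1, … and let the level of w_a be
-- the number of forward minus backward letters among the first a letters of W.  A walk
-- tracing a word x raises the level by the height (forward minus backward letters) of x
-- and moves the index by at most the length of x.
-- Neither Q_k nor G_m = p((+(+-)^m)^m +) has two consecutive backward edges, so a
-- homomorphism from Q_j into them maps the initial and the final ++ of Q_j onto occurrences
-- of ++; these occur only at block starts i(2m+1) (i ≤ k in Q_k, i < m in G_m), which have
-- level i.  The two images are j levels but at most j(2j+1) indices apart, whence m ≤ j,
-- and the later one is again a block start, whence j ≤ k (resp. j < m).  So Q_j → Q_k
-- forces j = k, and Q_j ↛ G_m.
-- Conversely, if G_m → D with |D| ≤ m, two of the m+1 block boundaries of the image
-- coincide, and running m+1 blocks round the resulting closed walk maps Q_m into D.  For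
-- m ∈ S at least the total size of a finite 𝒟, G_m receives no Q_k, so it maps to some
-- D ∈ 𝒟, and then so does Q_m, contradicting the duality at G = D.

module Submission where

open import Defs
open import Data.Nat using (ℕ; zero; suc; _+_; _*_; _≤_; _<_; z≤n; s≤s; pred)
open import Data.Nat.Properties
open import Data.Nat.ListAction using (sum)
open import Data.Integer as ℤ using (ℤ; +_; -[1+_])
import Data.Integer.Properties as ℤ
open import Data.Integer.Tactic.RingSolver using (solve-∀)
open import Data.Fin using (Fin; toℕ) renaming (zero to fzero; suc to fsuc)
import Data.Fin as Fin
import Data.Fin.Properties as Fin
open import Data.Bool using (T)
open import Data.List using (List; []; _∷_; _++_; length; take; drop; head; map)
open import Data.List.Properties using (++-assoc; length-++)
open import Data.List.Membership.Propositional using (_∈_)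
open import Data.List.Relation.Unary.Any using (here; there)
open import Data.Maybe using (Maybe; just)
open import Data.Product using (Σ; ∃; ∃₂; _×_; _,_; proj₁; proj₂; map₁; map₂)
open import Data.Sum as Sum using (_⊎_; inj₁; inj₂)
open import Data.Empty using (⊥; ⊥-elim)
open import Data.Unit using (tt)
open import Relation.Nullary using (¬_; contradiction)
open import Relation.Binary.PropositionalEquality
open import Function using (_∘_; id)

-- Walks tracing a word

data Walk (H : Graph) : List Sign → Fin (size H) → Fin (size H) → Set where
  []       : ∀ {u} → Walk H [] u u
  forward  : ∀ {u x v w} → Edge H u x → Walk H w x v → Walk H (⊕ ∷ w) u v
  backward : ∀ {u x v w} → Edge H x u → Walk H w x v → Walk H (⊖ ∷ w) u v

module _ {H : Graph} where

  walk-++ : ∀ {w w′ u x v} → Walk H w u x → Walk H w′ x v → Walk H (w ++ w′) u v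
  walk-++ []             r′ = r′
  walk-++ (forward e r)  r′ = forward e (walk-++ r r′)
  walk-++ (backward e r) r′ = backward e (walk-++ r r′)

  walk-split : ∀ w {w′ u v} → Walk H (w ++ w′) u v → ∃ λ x → Walk H w u x × Walk H w′ x v
  walk-split []      r = _ , [] , r
  walk-split (⊕ ∷ w) (forward e r) with x , r₁ , r₂ ← walk-split w r = x , forward e r₁ , r₂
  walk-split (⊖ ∷ w) (backward e r) with x , r₁ , r₂ ← walk-split w r = x , backward e r₁ , r₂

pathEdge-suc : ∀ s w a b → T (pathEdge w a b) → T (pathEdge (s ∷ w) (suc a) (suc b))
pathEdge-suc s (t ∷ w) zero    (suc b) e = e
pathEdge-suc s (t ∷ w) (suc a) zero    e = e
pathEdge-suc s (t ∷ w) (suc a) (suc b) e = e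

pathEdge-pred : ∀ s w a b → T (pathEdge (s ∷ w) (suc a) (suc b)) → T (pathEdge w a b)
pathEdge-pred s w zero    (suc b) e = e
pathEdge-pred s w (suc a) zero    e = e
pathEdge-pred s w (suc a) (suc b) e = e

module _ {H : Graph} where

  tail-hom : ∀ {s w} → p (s ∷ w) ⟶ H → p w ⟶ H
  tail-hom {s} {w} (f , hom) = f ∘ fsuc , λ a b e → hom (fsuc a) (fsuc b) (pathEdge-suc s w (toℕ a) (toℕ b) e)

  hom⇒walk : ∀ {w} (h : p w ⟶ H) → ∃ (Walk H w (proj₁ h fzero))
  hom⇒walk {[]}    h           = _ , []
  hom⇒walk {⊕ ∷ w} h@(_ , hom) = map₂ (forward (hom fzero (fsuc fzero) tt)) (hom⇒walk (tail-hom h))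
  hom⇒walk {⊖ ∷ w} h@(_ , hom) = map₂ (backward (hom (fsuc fzero) fzero tt)) (hom⇒walk (tail-hom h))

  walk-vertex : ∀ {w u v} → Walk H w u v → Fin (suc (length w)) → Fin (size H)
  walk-vertex {u = u} r              fzero    = u
  walk-vertex         (forward e r)  (fsuc i) = walk-vertex r i
  walk-vertex         (backward e r) (fsuc i) = walk-vertex r i

  walk-vertex-hom : ∀ {w u v} (r : Walk H w u v) a b → T (pathEdge w (toℕ a) (toℕ b)) →
                    Edge H (walk-vertex r a) (walk-vertex r b)
  walk-vertex-hom (forward e r)  fzero           (fsuc fzero) _ = e
  walk-vertex-hom (backward e r) (fsuc fzero)    fzero        _ = e
  walk-vertex-hom (forward e r)  (fsuc a) (fsuc b) e′ = walk-vertex-hom r a b (pathEdge-pred ⊕ _ (toℕ a) (toℕ b) e′)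
  walk-vertex-hom (backward e r) (fsuc a) (fsuc b) e′ = walk-vertex-hom r a b (pathEdge-pred ⊖ _ (toℕ a) (toℕ b) e′)
  walk-vertex-hom (forward e r)  (fsuc fzero)    fzero ()
  walk-vertex-hom (forward e r)  (fsuc (fsuc a)) fzero ()
  walk-vertex-hom (backward e r) fzero (fsuc fzero)    ()
  walk-vertex-hom (backward e r) fzero (fsuc (fsuc b)) ()

  walk⇒hom : ∀ {w u v} → Walk H w u v → p w ⟶ H
  walk⇒hom r = walk-vertex r , walk-vertex-hom r

-- Levels and distances in oriented paths

letterAt : List Sign → ℕ → Maybe Sign
letterAt w a = head (drop a w)

pathEdge⇒step : ∀ w a b → T (pathEdge w a b) →
                (b ≡ suc a × letterAt w a ≡ just ⊕) ⊎ (a ≡ suc b × letterAt w b ≡ just ⊖)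
pathEdge⇒step (⊕ ∷ w) zero       (suc zero) e = inj₁ (refl , refl)
pathEdge⇒step (⊖ ∷ w) (suc zero) zero       e = inj₂ (refl , refl)
pathEdge⇒step (s ∷ w) (suc (suc a)) (suc (suc b)) e = shift (pathEdge⇒step w (suc a) (suc b) e)
  where shift = Sum.map (map₁ (cong suc)) (map₁ (cong suc))
pathEdge⇒step (s ∷ w) (suc zero) (suc (suc b)) e with pathEdge⇒step w zero (suc b) e
... | inj₁ (refl , l) = inj₁ (refl , l)
pathEdge⇒step (s ∷ w) (suc (suc a)) (suc zero) e with pathEdge⇒step w (suc a) zero e
... | inj₂ (refl , l) = inj₂ (refl , l)

sign : Sign → ℤ
sign ⊕ = + 1
sign ⊖ = -[1+ 0 ]

height : List Sign → ℤ
height []      = + 0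
height (s ∷ w) = sign s ℤ.+ height w

level : List Sign → ℕ → ℤ
level w a = height (take a w)

level-suc : ∀ w a {s} → letterAt w a ≡ just s → level w (suc a) ≡ level w a ℤ.+ sign s
level-suc (s ∷ w) zero    refl = ℤ.+-comm (sign s) (+ 0)
level-suc (t ∷ w) (suc a) {s} l = begin
  sign t ℤ.+ level w (suc a)         ≡⟨ cong (λ z → sign t ℤ.+ z) (level-suc w a l) ⟩
  sign t ℤ.+ (level w a ℤ.+ sign s)  ≡⟨ ℤ.+-assoc (sign t) _ (sign s) ⟨
  sign t ℤ.+ level w a ℤ.+ sign s    ∎
  where open ≡-Reasoning

pathEdge⇒level-suc : ∀ w a b → T (pathEdge w a b) → level w b ≡ level w a ℤ.+ + 1
pathEdge⇒level-suc w a b e with pathEdge⇒step w a b e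
... | inj₁ (refl , l) = level-suc w a l
... | inj₂ (refl , l) = begin
  level w b                          ≡⟨ z≡z-1+1 (level w b) ⟩
  level w b ℤ.+ -[1+ 0 ] ℤ.+ + 1     ≡⟨ cong (λ z → z ℤ.+ + 1) (level-suc w b l) ⟨
  level w (suc b) ℤ.+ + 1            ∎
  where
  open ≡-Reasoning
  z≡z-1+1 : ∀ z → z ≡ z ℤ.+ -[1+ 0 ] ℤ.+ + 1
  z≡z-1+1 = solve-∀

walk-level : ∀ {W w u v} → Walk (p W) w u v → level W (toℕ v) ≡ level W (toℕ u) ℤ.+ height w
walk-level                 []                            = sym (ℤ.+-identityʳ _)
walk-level {W} {u = u} {v} (forward {x = x} {w = w} e r) = begin
  level W (toℕ v)                            ≡⟨ walk-level r ⟩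
  level W (toℕ x) ℤ.+ height w               ≡⟨ cong (λ z → z ℤ.+ height w) (pathEdge⇒level-suc W _ _ e) ⟩
  level W (toℕ u) ℤ.+ + 1 ℤ.+ height w       ≡⟨ ℤ.+-assoc (level W (toℕ u)) (+ 1) (height w) ⟩
  level W (toℕ u) ℤ.+ (+ 1 ℤ.+ height w)     ∎
  where open ≡-Reasoning
walk-level {W} {u = u} {v} (backward {x = x} {w = w} e r) = begin
  level W (toℕ v)                                      ≡⟨ walk-level r ⟩
  level W (toℕ x) ℤ.+ height w                         ≡⟨ insert-+1-1 (level W (toℕ x)) (height w) ⟩
  level W (toℕ x) ℤ.+ + 1 ℤ.+ (-[1+ 0 ] ℤ.+ height w)  ≡⟨ cong (λ z → z ℤ.+ (-[1+ 0 ] ℤ.+ height w))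
                                                               (pathEdge⇒level-suc W _ _ e) ⟨
  level W (toℕ u) ℤ.+ (-[1+ 0 ] ℤ.+ height w)          ∎
  where
  open ≡-Reasoning
  insert-+1-1 : ∀ z h → z ℤ.+ h ≡ z ℤ.+ + 1 ℤ.+ (-[1+ 0 ] ℤ.+ h)
  insert-+1-1 = solve-∀

pathEdge⇒adjacent : ∀ w a b → T (pathEdge w a b) → b ≤ suc a × a ≤ suc b
pathEdge⇒adjacent w a b e with pathEdge⇒step w a b e
... | inj₁ (refl , _) = ≤-refl , m≤n⇒m≤1+n (n≤1+n a)
... | inj₂ (refl , _) = m≤n⇒m≤1+n (n≤1+n b) , ≤-refl

walk-distance : ∀ {W w u v} → Walk (p W) w u v → toℕ v ≤ toℕ u + length w
walk-distance {u = u} []                                  = m≤m+n (toℕ u) 0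
walk-distance {W} {u = u} {v} (forward {x = x} {w = w} e r) = begin
  toℕ v                    ≤⟨ walk-distance {W} r ⟩
  toℕ x + length w         ≤⟨ +-monoˡ-≤ (length w) (proj₁ (pathEdge⇒adjacent W _ _ e)) ⟩
  suc (toℕ u) + length w   ≡⟨ +-suc (toℕ u) (length w) ⟨
  toℕ u + suc (length w)   ∎
  where open ≤-Reasoning
walk-distance {W} {u = u} {v} (backward {x = x} {w = w} e r) = begin
  toℕ v                    ≤⟨ walk-distance {W} r ⟩
  toℕ x + length w         ≤⟨ +-monoˡ-≤ (length w) (proj₂ (pathEdge⇒adjacent W _ _ e)) ⟩
  suc (toℕ u) + length w   ≡⟨ +-suc (toℕ u) (length w) ⟨
  toℕ u + suc (length w)   ∎
  where open ≤-Reasoning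

DoublePlusAt : List Sign → ℕ → Set
DoublePlusAt w a = letterAt w a ≡ just ⊕ × letterAt w (suc a) ≡ just ⊕

NoDoubleMinus : List Sign → Set
NoDoubleMinus w = ∀ a → letterAt w a ≡ just ⊖ → letterAt w (suc a) ≡ just ⊖ → ⊥

pathEdge²⇒doublePlus : ∀ W a b c → NoDoubleMinus W →
                       T (pathEdge W a b) → T (pathEdge W b c) → DoublePlusAt W a
pathEdge²⇒doublePlus W a b c noMM e₁ e₂ with pathEdge⇒step W a b e₁ | pathEdge⇒step W b c e₂
... | inj₁ (refl , l₁) | inj₁ (refl , l₂) = l₁ , l₂
... | inj₁ (refl , l₁) | inj₂ (eq , l₂) rewrite suc-injective eq = contradiction (trans (sym l₁) l₂) λ ()
... | inj₂ (refl , l₁) | inj₁ (refl , l₂) = contradiction (trans (sym l₁) l₂) λ ()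
... | inj₂ (refl , l₁) | inj₂ (refl , l₂) = ⊥-elim (noMM c l₂ l₁)

walk⇒doublePlus : ∀ {W w u v} → NoDoubleMinus W → Walk (p W) (⊕ ∷ ⊕ ∷ w) u v → DoublePlusAt W (toℕ u)
walk⇒doublePlus {W} noMM (forward e₁ (forward e₂ _)) = pathEdge²⇒doublePlus W _ _ _ noMM e₁ e₂

noDoubleMinus-[] : NoDoubleMinus []
noDoubleMinus-[] zero    ()
noDoubleMinus-[] (suc a) ()

noDoubleMinus-⊕∷ : ∀ {w} → NoDoubleMinus w → NoDoubleMinus (⊕ ∷ w)
noDoubleMinus-⊕∷ noMM (suc a) = noMM a

-- Words built from blocks

zigzag : ℕ → List Sign
zigzag n = rep n (⊕ ∷ ⊖ ∷ [])

block : ℕ → List Sign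
block n = ⊕ ∷ zigzag n

period : ℕ → ℕ
period n = length (block n)

length-rep : ∀ k w → length (rep k w) ≡ k * length w
length-rep zero    w = refl
length-rep (suc k) w = trans (length-++ w) (cong (λ l → length w + l) (length-rep k w))

height-++ : ∀ w w′ → height (w ++ w′) ≡ height w ℤ.+ height w′
height-++ []      w′ = sym (ℤ.+-identityˡ _)
height-++ (s ∷ w) w′ = trans (cong (λ z → sign s ℤ.+ z) (height-++ w w′)) (sym (ℤ.+-assoc (sign s) _ _))

+1-1-cancel : ∀ z → + 1 ℤ.+ (-[1+ 0 ] ℤ.+ z) ≡ z
+1-1-cancel = solve-∀

height-zigzag : ∀ n → height (zigzag n) ≡ + 0
height-zigzag zero    = refl
height-zigzag (suc n) = trans (+1-1-cancel (height (zigzag n))) (height-zigzag n)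

height-rep-block : ∀ k n → height (rep k (block n)) ≡ + k
height-rep-block zero    n = refl
height-rep-block (suc k) n = begin
  height (block n ++ rep k (block n))                     ≡⟨ height-++ (block n) _ ⟩
  + 1 ℤ.+ height (zigzag n) ℤ.+ height (rep k (block n))  ≡⟨ cong₂ (λ a b → + 1 ℤ.+ a ℤ.+ b)
                                                                   (height-zigzag n) (height-rep-block k n) ⟩
  + suc k                                                 ∎
  where open ≡-Reasoning

period-cancel-≤ : ∀ m j → period m ≤ period j → m ≤ j
period-cancel-≤ zero    j       _              = z≤n
period-cancel-≤ (suc m) (suc j) (s≤s (s≤s le)) = s≤s (period-cancel-≤ m j le)

doublePlus-zigzag : ∀ n {X} a → DoublePlusAt (zigzag n ++ X) a →
                    ∃ λ a′ → a ≡ length (zigzag n) + a′ × DoublePlusAt X a′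
doublePlus-zigzag zero    a             dp = a , refl , dp
doublePlus-zigzag (suc n) (suc (suc a)) dp = map₂ (map₁ (cong (suc ∘ suc))) (doublePlus-zigzag n a dp)

level-zigzag : ∀ n {X} a → level (zigzag n ++ X) (length (zigzag n) + a) ≡ level X a
level-zigzag zero    a = refl
level-zigzag (suc n) {X} a = trans (+1-1-cancel _) (level-zigzag n a)

StartsWith⊕ : List Sign → Set
StartsWith⊕ w = letterAt w 0 ≡ just ⊕

zigzag-startsWith⊕ : ∀ n {X} → StartsWith⊕ X → StartsWith⊕ (zigzag n ++ X)
zigzag-startsWith⊕ zero    h = h
zigzag-startsWith⊕ (suc n) h = refl

noDoubleMinus-zigzag : ∀ n {X} → NoDoubleMinus X → StartsWith⊕ X → NoDoubleMinus (zigzag n ++ X)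
noDoubleMinus-zigzag zero    noMM h = noMM
noDoubleMinus-zigzag (suc n) noMM h (suc zero) _ l rewrite zigzag-startsWith⊕ n h = contradiction l λ ()
noDoubleMinus-zigzag (suc n) noMM h (suc (suc a)) = noDoubleMinus-zigzag n noMM h a

rep-suc-++ : ∀ k w T → rep (suc k) w ++ T ≡ w ++ (rep k w ++ T)
rep-suc-++ k w T = ++-assoc w (rep k w) T

doublePlus-blocks : ∀ k n {T} a → DoublePlusAt (rep k (block n) ++ T) a →
                    (∃ λ i → i < k × a ≡ i * period n) ⊎ (∃ λ a′ → a ≡ k * period n + a′ × DoublePlusAt T a′)
doublePlus-blocks zero    n a       dp = inj₂ (a , refl , dp)
doublePlus-blocks (suc k) n zero    dp = inj₁ (0 , s≤s z≤n , refl)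
doublePlus-blocks (suc k) n {T} (suc a) dp
  with a′ , refl , dp′ ← doublePlus-zigzag n a (subst (λ w → DoublePlusAt w (suc a)) (rep-suc-++ k (block n) T) dp)
  with doublePlus-blocks k n a′ dp′
... | inj₁ (i , i<k , refl)  = inj₁ (suc i , s≤s i<k , refl)
... | inj₂ (a″ , refl , dp″) = inj₂ (a″ , cong suc (sym (+-assoc (length (zigzag n)) (k * period n) a″)) , dp″)

level-blocks : ∀ k n {T} i → i ≤ k → level (rep k (block n) ++ T) (i * period n) ≡ + i
level-blocks k       n     zero    _         = refl
level-blocks (suc k) n {T} (suc i) (s≤s i≤k) = begin
  level (rep (suc k) (block n) ++ T) (suc i * period n)          ≡⟨ cong (λ w → level w (suc i * period n))
                                                                         (rep-suc-++ k (block n) T) ⟩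
  + 1 ℤ.+ level (zigzag n ++ rep k (block n) ++ T) (length (zigzag n) + i * period n)
                                                                 ≡⟨ cong (λ z → + 1 ℤ.+ z) (level-zigzag n (i * period n)) ⟩
  + 1 ℤ.+ level (rep k (block n) ++ T) (i * period n)            ≡⟨ cong (λ z → + 1 ℤ.+ z) (level-blocks k n i i≤k) ⟩
  + suc i                                                        ∎
  where open ≡-Reasoning

blocks-startsWith⊕ : ∀ k n {T} → StartsWith⊕ T → StartsWith⊕ (rep k (block n) ++ T)
blocks-startsWith⊕ zero    n h = h
blocks-startsWith⊕ (suc k) n h = refl

noDoubleMinus-blocks : ∀ k n {T} → NoDoubleMinus T → StartsWith⊕ T → NoDoubleMinus (rep k (block n) ++ T)
noDoubleMinus-blocks zero    n     noMM h = noMM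
noDoubleMinus-blocks (suc k) n {T} noMM h =
  subst NoDoubleMinus (sym (rep-suc-++ k (block n) T)) noMM-block
  where
  noMM-block : NoDoubleMinus (block n ++ rep k (block n) ++ T)
  noMM-block (suc a) = noDoubleMinus-zigzag n (noDoubleMinus-blocks k n noMM h) (blocks-startsWith⊕ k n h) a

-- Homomorphisms into block-shaped paths

record BlockShaped (W : List Sign) (m bound : ℕ) : Set where
  field
    noDoubleMinus     : NoDoubleMinus W
    doublePlus⇒start : ∀ a → DoublePlusAt W a → ∃ λ i → i ≤ bound × a ≡ i * period m
    level-start       : ∀ i → i ≤ bound → level W (i * period m) ≡ + i

module _ {W m bound} (shape : BlockShaped W m bound) where
  open BlockShaped shape

  Q⟶blockShaped⇒bounds : ∀ {j} → 1 ≤ j → Q j ⟶ p W → m ≤ j × j ≤ bound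
  Q⟶blockShaped⇒bounds {j@(suc _)} _ hom@(f , _) with v , r ← hom⇒walk hom
    with i₀ , i₀≤bound , f₀≡ ← doublePlus⇒start (toℕ (f fzero)) (walk⇒doublePlus noDoubleMinus r)
    with x , r₁ , r₂ ← walk-split (rep j (block j)) r
    with i₁ , i₁≤bound , x≡ ← doublePlus⇒start (toℕ x) (walk⇒doublePlus noDoubleMinus r₂)
    = period-cancel-≤ m j (*-cancelˡ-≤ j jPm≤jPj) , m+n≤o⇒n≤o i₀ (subst (_≤ bound) i₁≡i₀+j i₁≤bound)
    where
    i₁≡i₀+j : i₁ ≡ i₀ + j
    i₁≡i₀+j = ℤ.+-injective (begin
      + i₁                                                  ≡⟨ trans (cong (level W) x≡) (level-start i₁ i₁≤bound) ⟨
      level W (toℕ x)                                       ≡⟨ walk-level r₁ ⟩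
      level W (toℕ (f fzero)) ℤ.+ height (rep j (block j))  ≡⟨ cong₂ ℤ._+_ (trans (cong (level W) f₀≡) (level-start i₀ i₀≤bound))
                                                                            (height-rep-block j j) ⟩
      + (i₀ + j)                                            ∎)
      where open ≡-Reasoning

    jPm≤jPj : j * period m ≤ j * period j
    jPm≤jPj = +-cancelˡ-≤ (i₀ * period m) _ _ (begin
      i₀ * period m + j * period m              ≡⟨ *-distribʳ-+ (period m) i₀ j ⟨
      (i₀ + j) * period m                       ≡⟨ cong (_* period m) i₁≡i₀+j ⟨
      i₁ * period m                             ≡⟨ x≡ ⟨
      toℕ x                                     ≤⟨ walk-distance {W} r₁ ⟩
      toℕ (f fzero) + length (rep j (block j))  ≡⟨ cong₂ _+_ f₀≡ (length-rep j (block j)) ⟩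
      i₀ * period m + j * period j              ∎)
      where open ≤-Reasoning

G : ℕ → Graph
G m = p (rep m (block m) ++ ⊕ ∷ [])

G-blockShaped : ∀ m → BlockShaped (rep m (block m) ++ ⊕ ∷ []) m (pred m)
G-blockShaped m = record
  { noDoubleMinus     = noDoubleMinus-blocks m m (noDoubleMinus-⊕∷ noDoubleMinus-[]) refl
  ; doublePlus⇒start = start
  ; level-start       = λ i i≤pred → level-blocks m m i (≤pred⇒≤ i≤pred)
  }
  where
  start : ∀ a → DoublePlusAt (rep m (block m) ++ ⊕ ∷ []) a → ∃ λ i → i ≤ pred m × a ≡ i * period m
  start a dp with doublePlus-blocks m m a dp
  ... | inj₁ (i , i<m , a≡)       = i , <⇒≤pred i<m , a≡
  ... | inj₂ (zero        , _ , _ , ())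
  ... | inj₂ (suc zero    , _ , () , _)
  ... | inj₂ (suc (suc _) , _ , () , _)

Q-blockShaped : ∀ k → BlockShaped (rep k (block k) ++ ⊕ ∷ ⊕ ∷ []) k k
Q-blockShaped k = record
  { noDoubleMinus     = noDoubleMinus-blocks k k (noDoubleMinus-⊕∷ (noDoubleMinus-⊕∷ noDoubleMinus-[])) refl
  ; doublePlus⇒start = start
  ; level-start       = λ i → level-blocks k k i
  }
  where
  start : ∀ a → DoublePlusAt (rep k (block k) ++ ⊕ ∷ ⊕ ∷ []) a → ∃ λ i → i ≤ k × a ≡ i * period k
  start a dp with doublePlus-blocks k k a dp
  ... | inj₁ (i , i<k , a≡)     = i , <⇒≤ i<k , a≡
  ... | inj₂ (zero , a≡ , _)    = k , ≤-refl , trans a≡ (+-identityʳ (k * period k))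
  ... | inj₂ (suc zero , _ , _ , ())
  ... | inj₂ (suc (suc zero) , _ , () , _)
  ... | inj₂ (suc (suc (suc _)) , _ , () , _)

Q⟶Q⇒≡ : ∀ {j k} → 1 ≤ j → Q j ⟶ Q k → j ≡ k
Q⟶Q⇒≡ 1≤j hom with k≤j , j≤k ← Q⟶blockShaped⇒bounds (Q-blockShaped _) 1≤j hom = ≤-antisym j≤k k≤j

Q↛G : ∀ {j m} → 1 ≤ j → 1 ≤ m → ¬ (Q j ⟶ G m)
Q↛G {m = suc m} 1≤j _ hom with m<j , j≤m ← Q⟶blockShaped⇒bounds (G-blockShaped (suc m)) 1≤j hom =
  <-irrefl refl (≤-trans m<j j≤m)

-- Cycles of a relation on a finite set

data Steps {V : Set} (R : V → V → Set) : ℕ → V → V → Set where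
  []  : ∀ {a} → Steps R 0 a a
  _∷_ : ∀ {k a b c} → R a b → Steps R k b c → Steps R (suc k) a c

module _ {V : Set} {R : V → V → Set} where

  vertex : ∀ {k a b} → Steps R k a b → Fin (suc k) → V
  vertex {a = a} s       fzero    = a
  vertex         (e ∷ s) (fsuc i) = vertex s i

  prefix : ∀ {k a b} (s : Steps R k a b) (i : Fin (suc k)) → Steps R (toℕ i) a (vertex s i)
  prefix s       fzero    = []
  prefix (e ∷ s) (fsuc i) = e ∷ prefix s i

  repeated-vertex⇒cycle : ∀ {k a b} (s : Steps R k a b) {i j : Fin (suc k)} →
                          i Fin.< j → vertex s i ≡ vertex s j → ∃ λ d → Steps R (suc d) (vertex s i) (vertex s i)
  repeated-vertex⇒cycle (e ∷ s) {fzero}  {fsuc j} _         eq = toℕ j , subst (Steps R _ _) (sym eq) (e ∷ prefix s j)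
  repeated-vertex⇒cycle (e ∷ s) {fsuc i} {fsuc j} (s≤s i<j) eq = repeated-vertex⇒cycle s i<j eq

  cycle⇒steps : ∀ {d w} → Steps R (suc d) w w → ∀ k → ∃ (Steps R k w)
  cycle⇒steps {w = w} (e₀ ∷ s₀) = around []
    where
    around : ∀ {r a} → Steps R r a w → ∀ k → ∃ (Steps R k a)
    around _       zero    = _ , []
    around []      (suc k) = map₂ (e₀ ∷_) (around s₀ k)
    around (e ∷ s) (suc k) = map₂ (e ∷_) (around s k)

  unsnoc : ∀ {k a c} → Steps R (suc k) a c → ∃ λ b → Steps R k a b × R b c
  unsnoc (e ∷ [])        = _ , [] , e
  unsnoc (e ∷ s@(_ ∷ _)) = map₂ (map₁ (e ∷_)) (unsnoc s)

long-steps⇒cycle : ∀ {n} {R : Fin n → Fin n → Set} {k a b} → n ≤ k → Steps R k a b →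
                   ∃₂ λ w d → Steps R (suc d) w w
long-steps⇒cycle n≤k s with i , j , i<j , eq ← Fin.pigeonhole (s≤s n≤k) (vertex s) = _ , repeated-vertex⇒cycle s i<j eq

-- Small targets of G_m

module _ {H : Graph} where

  steps⇒walk-rep : ∀ {k w a b} → Steps (Walk H w) k a b → Walk H (rep k w) a b
  steps⇒walk-rep []      = []
  steps⇒walk-rep (r ∷ s) = walk-++ r (steps⇒walk-rep s)

  walk-rep⇒steps : ∀ k {w a b} → Walk H (rep k w) a b → Steps (Walk H w) k a b
  walk-rep⇒steps zero    []                           = []
  walk-rep⇒steps (suc k) {w} r with x , r₁ , r₂ ← walk-split w r = r₁ ∷ walk-rep⇒steps k r₂

  walk-block⇒walk-⊕⊕ : ∀ {n a b} → 1 ≤ n → Walk H (block n) a b → ∃ (Walk H (⊕ ∷ ⊕ ∷ []) a)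
  walk-block⇒walk-⊕⊕ {suc n} _ (forward e₁ (forward e₂ _)) = _ , forward e₁ (forward e₂ [])

G⟶small⇒Q⟶ : ∀ {m D} → 1 ≤ m → size D ≤ m → G m ⟶ D → Q m ⟶ D
G⟶small⇒Q⟶ {m} {D} 1≤m small hom
  with v , r ← hom⇒walk {D} hom
  with x , blocks , _ ← walk-split (rep m (block m)) r
  with w , d , cycle ← long-steps⇒cycle small (walk-rep⇒steps m blocks)
  with y , blocks′ , lastBlock ← unsnoc (proj₂ (cycle⇒steps cycle (suc m)))
  with z , ⊕⊕ ← walk-block⇒walk-⊕⊕ 1≤m lastBlock
  = walk⇒hom (walk-++ (steps⇒walk-rep blocks′) ⊕⊕)

⟶-refl : ∀ {H} → H ⟶ H
⟶-refl = id , λ _ _ e → e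

∈⇒size≤sum : ∀ {D 𝒟} → D ∈ 𝒟 → size D ≤ sum (map size 𝒟)
∈⇒size≤sum {𝒟 = D ∷ 𝒟} (here refl) = m≤m+n (size D) _
∈⇒size≤sum {𝒟 = E ∷ 𝒟} (there D∈𝒟) = ≤-trans (∈⇒size≤sum D∈𝒟) (m≤n+m _ (size E))

mainTheorem5 : (S : ℕ → Set) → InfiniteIndexSet S →
    QAntichain S × ¬ (Σ (List Graph) λ 𝒟 → QDualityPair S 𝒟)
mainTheorem5 S (S⇒1≤ , unbounded) = antichain , no-finite-dual
  where
  antichain : QAntichain S
  antichain j k Sj _ j≢k hom = j≢k (Q⟶Q⇒≡ (S⇒1≤ j Sj) hom)

  no-finite-dual : ¬ (Σ (List Graph) λ 𝒟 → QDualityPair S 𝒟)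
  no-finite-dual (𝒟 , dual) with m , total≤m , Sm ← unbounded (sum (map size 𝒟)) with proj₁ (dual (G m))
  ... | inj₁ (k , Sk , hom)  = Q↛G (S⇒1≤ k Sk) (S⇒1≤ m Sm) hom
  ... | inj₂ (D , D∈𝒟 , hom) = proj₂ (dual D) (Q⟶D , D , D∈𝒟 , ⟶-refl {D})
    where
    Q⟶D : ∃ λ k → S k × (Q k ⟶ D)
    Q⟶D = m , Sm , G⟶small⇒Q⟶ {D = D} (S⇒1≤ m Sm) (≤-trans (∈⇒size≤sum D∈𝒟) total≤m) hom
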